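{- Let $G$ be a finite simple graph and let $S\in\mathrm{MaxCritIndep}(G)$. Then $2\alpha'(G)=d(\ker(G))+|N[S]|$.
   Context: For a graph $G$ and $A\subseteq V(G)$: $N(A)=\{v\in V(G): v \text{ has a neighbor in } A\}$ and $N[A]=N(A)\cup A$. A set is independent if no two of its vertices are adjacent; $\mathrm{Ind}(G)$ is the family of independent sets. The difference of $X\subseteq V(G)$ is $d(X)=|X|-|N(X)|$. An independent set $A$ is critical if $d(A)=\max\{d(I):I\in\mathrm{Ind}(G)\}$. A maximum critical independent set is a critical independent set of maximum cardinality among all critical independent sets; $\mathrm{MaxCritIndep}(G)$ denotes the family of all of them. The critical independence number $\alpha'(G)$ is the maximum cardinality of a critical independent set. $\ker(G)$ is the intersection of all critical independent sets of $G$. -}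

module Defs where

open import Data.Nat using (ℕ; _≤_)
open import Data.Integer using (ℤ; _-_; +_)
open import Data.Bool using (Bool; true; false; T)
open import Data.Fin using (Fin)
open import Data.Fin.Subset using (Subset; _∈_; _∪_; ∣_∣)
open import Data.Vec using (tabulate)
open import Data.Fin.Properties using (any?)
open import Data.Product using (_×_; ∃)
open import Relation.Nullary using (¬_)
open import Relation.Nullary.Decidable using (⌊_⌋)
open import Relation.Binary.PropositionalEquality using (_≡_)

record Graph (n : ℕ) : Set where
  field
    adj   : Fin n → Fin n → Bool
    sym   : ∀ u v → adj u v ≡ adj v u
    irrefl : ∀ v → adj v v ≡ false

open Graph public

module _ {n : ℕ} (G : Graph n) where

  -- N(A) = { v | v has a neighbour in A }
  N : Subset n → Subset n
  N A = tabulate (λ v → ⌊ any? (λ u → Data.Bool._≟_ (Data.Bool._∧_ (Data.Vec.lookup A u) (adj G v u)) true) ⌋)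
    where import Data.Bool
          import Data.Vec

  N[_] : Subset n → Subset n
  N[ A ] = N A ∪ A

  d : Subset n → ℤ
  d X = + ∣ X ∣ - + ∣ N X ∣

  Independent : Subset n → Set
  Independent A = ∀ u v → u ∈ A → v ∈ A → adj G u v ≡ false

  Critical : Subset n → Set
  Critical A = Independent A × (∀ I → Independent I → d I Data.Integer.≤ d A)
    where import Data.Integer

  MaxCritIndep : Subset n → Set
  MaxCritIndep S = Critical S × (∀ A → Critical A → ∣ A ∣ ≤ ∣ S ∣)

  IsCritIndepNumber : ℕ → Set
  IsCritIndepNumber k = (∃ λ A → Critical A × ∣ A ∣ ≡ k) × (∀ A → Critical A → ∣ A ∣ ≤ k)

  IsKer : Subset n → Set
  IsKer K = ∀ v → (v ∈ K → ∀ A → Critical A → v ∈ A) × ((∀ A → Critical A → v ∈ A) → v ∈ K)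

-- Since S is a largest critical independent set, α'(G) = |S|, and since S is
-- independent, S and N(S) are disjoint, so |N[S]| = |N(S)| + |S|.  Hence
-- 2α' = (|S| - |N(S)|) + (|N(S)| + |S|) = d(S) + |N[S]|, and it remains to show
-- d(ker G) = d(S), i.e. that ker G is itself critical.  This is the classical
-- fact that critical independent sets are closed under intersection:
--   * d is supermodular: d(A) + d(B) ≤ d(A ∩ B) + d(A ∪ B), because N(A ∩ B)
--     ⊆ N(A) ∩ N(B) and N(A ∪ B) ⊆ N(A) ∪ N(B) (inclusion–exclusion);
--   * every set X contains the independent set X ∖ N(X), whose difference is
--     at least d(X); so d(A ∪ B) ≤ max d, and supermodularity forces
--     d(A ∩ B) ≥ d(A) for critical A, B.
-- Intersecting a critical set with, for each vertex outside ker G, a critical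
-- set avoiding it yields ker G.  Finding those sets is only possible up to
-- double negation constructively, which suffices because d(ker G) = d(S) is
-- decidable.
module Submission where

open import Defs
open import Data.Nat using (ℕ)
open import Data.Fin.Subset using (Subset; ∣_∣)
open import Relation.Binary.PropositionalEquality using (_≡_)
import Relation.Binary.PropositionalEquality as ≡

module SubsetCardinality where

  open import Data.Nat using (suc; _+_; _≤_)
  open import Data.Nat.Properties using (+-suc; ≤-reflexive; ≤-trans)
  open import Data.Bool using (true; false)
  open import Data.Vec using ([]; _∷_)
  open import Data.Fin.Subset using (_⊆_; _∩_; _∪_; ∁; ⊤; Empty)
  open import Data.Fin.Subset.Properties
    using (Empty-unique; ∣⊥∣≡0; p⊆q⇒∣p∣≤∣q∣; x∈p∪q⁻; ∩-distribˡ-∪; p∪∁p≡⊤; ∩-identityʳ; x∈p∩q⁻; x∈p⇒x∉∁p)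
  open import Data.Product using (_,_; proj₂)
  open import Data.Sum using ([_,_])
  open import Relation.Binary.PropositionalEquality using (refl; cong; subst; module ≡-Reasoning)
  open ≡-Reasoning

  ∣p∩q∣+∣p∪q∣≡∣p∣+∣q∣ : ∀ {m} (p q : Subset m) → ∣ p ∩ q ∣ + ∣ p ∪ q ∣ ≡ ∣ p ∣ + ∣ q ∣
  ∣p∩q∣+∣p∪q∣≡∣p∣+∣q∣ []          []          = refl
  ∣p∩q∣+∣p∪q∣≡∣p∣+∣q∣ (true ∷ p)  (true ∷ q)  = cong suc (begin
    ∣ p ∩ q ∣ + suc ∣ p ∪ q ∣  ≡⟨ +-suc _ _ ⟩
    suc (∣ p ∩ q ∣ + ∣ p ∪ q ∣) ≡⟨ cong suc (∣p∩q∣+∣p∪q∣≡∣p∣+∣q∣ p q) ⟩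
    suc (∣ p ∣ + ∣ q ∣)         ≡⟨ +-suc _ _ ⟨
    ∣ p ∣ + suc ∣ q ∣           ∎)
  ∣p∩q∣+∣p∪q∣≡∣p∣+∣q∣ (true ∷ p)  (false ∷ q) = begin
    ∣ p ∩ q ∣ + suc ∣ p ∪ q ∣  ≡⟨ +-suc _ _ ⟩
    suc (∣ p ∩ q ∣ + ∣ p ∪ q ∣) ≡⟨ cong suc (∣p∩q∣+∣p∪q∣≡∣p∣+∣q∣ p q) ⟩
    suc (∣ p ∣ + ∣ q ∣)         ∎
  ∣p∩q∣+∣p∪q∣≡∣p∣+∣q∣ (false ∷ p) (true ∷ q)  = begin
    ∣ p ∩ q ∣ + suc ∣ p ∪ q ∣  ≡⟨ +-suc _ _ ⟩
    suc (∣ p ∩ q ∣ + ∣ p ∪ q ∣) ≡⟨ cong suc (∣p∩q∣+∣p∪q∣≡∣p∣+∣q∣ p q) ⟩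
    suc (∣ p ∣ + ∣ q ∣)         ≡⟨ +-suc _ _ ⟨
    ∣ p ∣ + suc ∣ q ∣           ∎
  ∣p∩q∣+∣p∪q∣≡∣p∣+∣q∣ (false ∷ p) (false ∷ q) = ∣p∩q∣+∣p∪q∣≡∣p∣+∣q∣ p q

  ∣p∪q∣≡∣p∣+∣q∣ : ∀ {m} (p q : Subset m) → Empty (p ∩ q) → ∣ p ∪ q ∣ ≡ ∣ p ∣ + ∣ q ∣
  ∣p∪q∣≡∣p∣+∣q∣ {m} p q disjoint = begin
    ∣ p ∪ q ∣             ≡⟨⟩
    0 + ∣ p ∪ q ∣         ≡⟨ cong (_+ ∣ p ∪ q ∣) ∣p∩q∣≡0 ⟨
    ∣ p ∩ q ∣ + ∣ p ∪ q ∣ ≡⟨ ∣p∩q∣+∣p∪q∣≡∣p∣+∣q∣ p q ⟩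
    ∣ p ∣ + ∣ q ∣         ∎
    where
      ∣p∩q∣≡0 : ∣ p ∩ q ∣ ≡ 0
      ∣p∩q∣≡0 = subst (λ r → ∣ r ∣ ≡ 0) (≡.sym (Empty-unique disjoint)) (∣⊥∣≡0 m)

  disjoint⇒∣p∣+∣q∣≤∣r∣ : ∀ {m} {p q r : Subset m} →
    Empty (p ∩ q) → p ⊆ r → q ⊆ r → ∣ p ∣ + ∣ q ∣ ≤ ∣ r ∣
  disjoint⇒∣p∣+∣q∣≤∣r∣ {p = p} {q} disjoint p⊆r q⊆r =
    ≤-trans (≤-reflexive (≡.sym (∣p∪q∣≡∣p∣+∣q∣ p q disjoint)))
            (p⊆q⇒∣p∣≤∣q∣ (λ {x} x∈p∪q → [ p⊆r , q⊆r ] (x∈p∪q⁻ p q x∈p∪q)))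

  ∣p∣≡∣p∩q∣+∣p∩∁q∣ : ∀ {m} (p q : Subset m) → ∣ p ∣ ≡ ∣ p ∩ q ∣ + ∣ p ∩ ∁ q ∣
  ∣p∣≡∣p∩q∣+∣p∩∁q∣ p q = begin
    ∣ p ∣                     ≡⟨ cong ∣_∣ (∩-identityʳ p) ⟨
    ∣ p ∩ ⊤ ∣                 ≡⟨ cong (λ r → ∣ p ∩ r ∣) (p∪∁p≡⊤ q) ⟨
    ∣ p ∩ (q ∪ ∁ q) ∣         ≡⟨ cong ∣_∣ (∩-distribˡ-∪ p q (∁ q)) ⟩
    ∣ (p ∩ q) ∪ (p ∩ ∁ q) ∣   ≡⟨ ∣p∪q∣≡∣p∣+∣q∣ (p ∩ q) (p ∩ ∁ q) disjoint ⟩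
    ∣ p ∩ q ∣ + ∣ p ∩ ∁ q ∣   ∎
    where
      disjoint : Empty ((p ∩ q) ∩ (p ∩ ∁ q))
      disjoint (x , x∈) with x∈p∩q⁻ (p ∩ q) (p ∩ ∁ q) x∈
      ... | x∈p∩q , x∈p∩∁q = x∈p⇒x∉∁p (proj₂ (x∈p∩q⁻ p q x∈p∩q)) (proj₂ (x∈p∩q⁻ p (∁ q) x∈p∩∁q))

module Neighbourhood {n : ℕ} (G : Graph n) where

  open import Data.Bool using (true; T; _∧_)
  open import Data.Bool.Properties using (T-≡)
  open import Function.Bundles using (Equivalence)
  open import Data.Fin.Subset using (_∈_; _⊆_; _∩_; _∪_; Empty)
  open import Data.Fin.Subset.Properties using (x∈p∩q⁺; x∈p∩q⁻; x∈p∪q⁺; x∈p∪q⁻)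
  open import Data.Vec.Properties using (lookup∘tabulate; []=⇒lookup; lookup⇒[]=)
  open import Data.Product using (∃; _×_; _,_; proj₁; proj₂)
  open import Data.Sum using (inj₁; inj₂)
  open import Relation.Nullary.Decidable using (toWitness; fromWitness)
  open import Relation.Binary.PropositionalEquality using (refl; subst; trans)

  private
    T⇒≡true : ∀ {b} → T b → b ≡ true
    T⇒≡true = Equivalence.to T-≡

    ≡true⇒T : ∀ {b} → b ≡ true → T b
    ≡true⇒T = Equivalence.from T-≡

    ∧≡true : ∀ {a b} → a ∧ b ≡ true → a ≡ true × b ≡ true
    ∧≡true {true} {true} _ = refl , refl

  ∈N⁺ : ∀ {A u v} → u ∈ A → adj G v u ≡ true → v ∈ N G A
  ∈N⁺ {A} {u} {v} u∈A vu = lookup⇒[]= v (N G A) (trans (lookup∘tabulate _ v)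
    (T⇒≡true (fromWitness (u , subst (λ b → b ∧ adj G v u ≡ true) (≡.sym ([]=⇒lookup u∈A)) vu))))

  ∈N⁻ : ∀ {A v} → v ∈ N G A → ∃ λ u → u ∈ A × adj G v u ≡ true
  ∈N⁻ {A} {v} v∈NA with toWitness (≡true⇒T (trans (≡.sym (lookup∘tabulate _ v)) ([]=⇒lookup v∈NA)))
  ... | u , uv = u , lookup⇒[]= u A (proj₁ (∧≡true uv)) , proj₂ (∧≡true uv)

  N-mono : ∀ {A B} → A ⊆ B → N G A ⊆ N G B
  N-mono A⊆B v∈NA with ∈N⁻ v∈NA
  ... | u , u∈A , vu = ∈N⁺ (A⊆B u∈A) vu

  N-∩ : ∀ A B → N G (A ∩ B) ⊆ N G A ∩ N G B
  N-∩ A B v∈ = x∈p∩q⁺ ( N-mono (λ {x} x∈ → proj₁ (x∈p∩q⁻ A B x∈)) v∈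
                     , N-mono (λ {x} x∈ → proj₂ (x∈p∩q⁻ A B x∈)) v∈)

  N-∪ : ∀ A B → N G (A ∪ B) ⊆ N G A ∪ N G B
  N-∪ A B v∈ with ∈N⁻ v∈
  ... | u , u∈A∪B , vu with x∈p∪q⁻ A B u∈A∪B
  ...   | inj₁ u∈A = x∈p∪q⁺ (inj₁ (∈N⁺ u∈A vu))
  ...   | inj₂ u∈B = x∈p∪q⁺ (inj₂ (∈N⁺ u∈B vu))

  independent⇒disjoint-N : ∀ {A} → Independent G A → Empty (N G A ∩ A)
  independent⇒disjoint-N {A} indA (v , v∈) with x∈p∩q⁻ (N G A) A v∈
  ... | v∈NA , v∈A with ∈N⁻ v∈NA
  ...   | u , u∈A , vu with trans (≡.sym vu) (indA v u v∈A u∈A)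
  ...     | ()

module Differences where

  import Data.Nat as ℕ
  import Data.Nat.Properties as ℕ
  open import Data.Integer using (ℤ; +_; -_; _+_; _-_; _*_; _⊖_; _≤_)
  open import Data.Integer.Properties
    using (m-n≡m⊖n; +-cancelˡ-⊖; ⊖-monoˡ-≤; pos-+; +-monoˡ-≤; module ≤-Reasoning)
  open import Data.Integer.Tactic.RingSolver using (solve-∀)
  open import Relation.Binary.PropositionalEquality using (cong; cong₂; subst₂)

  diff-≤ : ∀ a b c e → a ℕ.+ e ℕ.≤ c ℕ.+ b → + a - + b ≤ + c - + e
  diff-≤ a b c e a+e≤c+b = begin
    + a - + b             ≡⟨ m-n≡m⊖n a b ⟩
    a ⊖ b                 ≡⟨ +-cancelˡ-⊖ e a b ⟨
    (e ℕ.+ a) ⊖ (e ℕ.+ b) ≤⟨ ⊖-monoˡ-≤ (e ℕ.+ b) e+a≤b+c ⟩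
    (b ℕ.+ c) ⊖ (e ℕ.+ b) ≡⟨ cong ((b ℕ.+ c) ⊖_) (ℕ.+-comm e b) ⟩
    (b ℕ.+ c) ⊖ (b ℕ.+ e) ≡⟨ +-cancelˡ-⊖ b c e ⟩
    c ⊖ e                 ≡⟨ m-n≡m⊖n c e ⟨
    + c - + e             ∎
    where
      open ≤-Reasoning
      e+a≤b+c : e ℕ.+ a ℕ.≤ b ℕ.+ c
      e+a≤b+c = subst₂ ℕ._≤_ (ℕ.+-comm a e) (ℕ.+-comm c b) a+e≤c+b

  diff-+ : ∀ a b c e → (+ a - + b) + (+ c - + e) ≡ + (a ℕ.+ c) - + (b ℕ.+ e)
  diff-+ a b c e = ≡.trans (regroup (+ a) (+ b) (+ c) (+ e))
                           (≡.sym (cong₂ _-_ (pos-+ a c) (pos-+ b e)))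
    where
      regroup : ∀ (i j k l : ℤ) → (i - j) + (k - l) ≡ (i + k) - (j + l)
      regroup = solve-∀

  +-cancelʳ-≤ : ∀ {i j} k → i + k ≤ j + k → i ≤ j
  +-cancelʳ-≤ {i} {j} k i+k≤j+k =
    subst₂ _≤_ (add-sub i k) (add-sub j k) (+-monoˡ-≤ (- k) i+k≤j+k)
    where
      add-sub : ∀ (x y : ℤ) → (x + y) + - y ≡ x
      add-sub = solve-∀

  twice≡diff+sum : ∀ a b → + 2 * + a ≡ (+ a - + b) + + (b ℕ.+ a)
  twice≡diff+sum a b = ≡.trans (identity (+ a) (+ b)) (cong (λ s → (+ a - + b) + s) (≡.sym (pos-+ b a)))
    where
      identity : ∀ (x y : ℤ) → + 2 * x ≡ (x - y) + (y + x)
      identity = solve-∀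

module CriticalSets {n : ℕ} (G : Graph n) where

  open SubsetCardinality
  open Neighbourhood G
  open Differences using (diff-≤; diff-+; +-cancelʳ-≤)
  import Data.Nat as ℕ
  import Data.Nat.Properties as ℕ
  open import Data.Nat.Tactic.RingSolver using () renaming (solve-∀ to ℕ-solve-∀)
  open import Data.Integer using (+_; _+_; _-_; _≤_)
  open import Data.Integer.Properties using (≤-trans; ≤-antisym; +-monoʳ-≤; module ≤-Reasoning)
  open import Data.Bool using (true; false)
  open import Data.Fin.Subset using (_∈_; _∩_; _∪_; ∁; Empty)
  open import Data.Fin.Subset.Properties
    using (p⊆q⇒∣p∣≤∣q∣; x∈p∩q⁻; p∩q⊆p; p∩q⊆q; x∈∁p⇒x∉p)
  open import Data.Product using (_,_; proj₂)
  open import Data.Empty using (⊥; ⊥-elim)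

  -- d(A) + d(B) ≤ d(A ∩ B) + d(A ∪ B): the vertex counts agree by
  -- inclusion–exclusion while the neighbourhoods of A ∩ B and A ∪ B are
  -- covered by N(A) ∩ N(B) and N(A) ∪ N(B).
  d-supermodular : ∀ A B → d G A + d G B ≤ d G (A ∩ B) + d G (A ∪ B)
  d-supermodular A B = begin
    d G A + d G B
      ≡⟨ diff-+ (∣ A ∣) (∣ N G A ∣) (∣ B ∣) (∣ N G B ∣) ⟩
    + (∣ A ∣ ℕ.+ ∣ B ∣) - + (∣ N G A ∣ ℕ.+ ∣ N G B ∣)
      ≤⟨ diff-≤ (∣ A ∣ ℕ.+ ∣ B ∣) (∣ N G A ∣ ℕ.+ ∣ N G B ∣) _ _ counting ⟩
    + (∣ A ∩ B ∣ ℕ.+ ∣ A ∪ B ∣) - + (∣ N G (A ∩ B) ∣ ℕ.+ ∣ N G (A ∪ B) ∣)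
      ≡⟨ diff-+ (∣ A ∩ B ∣) (∣ N G (A ∩ B) ∣) (∣ A ∪ B ∣) (∣ N G (A ∪ B) ∣) ⟨
    d G (A ∩ B) + d G (A ∪ B) ∎
    where
      open ≤-Reasoning
      N-bound : ∣ N G (A ∩ B) ∣ ℕ.+ ∣ N G (A ∪ B) ∣ ℕ.≤ ∣ N G A ∣ ℕ.+ ∣ N G B ∣
      N-bound = ℕ.≤-trans
        (ℕ.+-mono-≤ (p⊆q⇒∣p∣≤∣q∣ (N-∩ A B)) (p⊆q⇒∣p∣≤∣q∣ (N-∪ A B)))
        (ℕ.≤-reflexive (∣p∩q∣+∣p∪q∣≡∣p∣+∣q∣ (N G A) (N G B)))
      counting : (∣ A ∣ ℕ.+ ∣ B ∣) ℕ.+ (∣ N G (A ∩ B) ∣ ℕ.+ ∣ N G (A ∪ B) ∣)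
                 ℕ.≤ (∣ A ∩ B ∣ ℕ.+ ∣ A ∪ B ∣) ℕ.+ (∣ N G A ∣ ℕ.+ ∣ N G B ∣)
      counting = ℕ.+-mono-≤ (ℕ.≤-reflexive (≡.sym (∣p∩q∣+∣p∪q∣≡∣p∣+∣q∣ A B))) N-bound

  independentPart : Subset n → Subset n
  independentPart X = X ∩ ∁ (N G X)

  independentPart-isolated : ∀ X {u v} → u ∈ independentPart X → v ∈ X → adj G u v ≡ true → ⊥
  independentPart-isolated X u∈I v∈X uv =
    x∈∁p⇒x∉p (proj₂ (x∈p∩q⁻ X (∁ (N G X)) u∈I)) (∈N⁺ v∈X uv)

  independentPart-independent : ∀ X → Independent G (independentPart X)
  independentPart-independent X u v u∈I v∈I with adj G u v in uv
  ... | false = ≡.refl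
  ... | true  = ⊥-elim (independentPart-isolated X u∈I (p∩q⊆p X _ v∈I) uv)

  -- X splits as independentPart X and X ∩ N(X); the latter and
  -- N(independentPart X) are disjoint subsets of N(X), which gives
  -- |X| + |N(I)| ≤ |I| + |N(X)| for I = independentPart X.
  d≤d-independentPart : ∀ X → d G X ≤ d G (independentPart X)
  d≤d-independentPart X = diff-≤ (∣ X ∣) (∣ N G X ∣) (∣ I ∣) (∣ N G I ∣) counting
    where
      I = independentPart X
      disjoint : Empty (N G I ∩ (X ∩ N G X))
      disjoint (v , v∈) with x∈p∩q⁻ (N G I) (X ∩ N G X) v∈
      ... | v∈NI , v∈X∩NX with ∈N⁻ v∈NI
      ...   | u , u∈I , vu = independentPart-isolated X u∈I (p∩q⊆p X _ v∈X∩NX)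
                               (≡.trans (Graph.sym G u v) vu)
      parts-of-NX : ∣ N G I ∣ ℕ.+ ∣ X ∩ N G X ∣ ℕ.≤ ∣ N G X ∣
      parts-of-NX = disjoint⇒∣p∣+∣q∣≤∣r∣ disjoint (N-mono (p∩q⊆p X _)) (p∩q⊆q X _)
      rearrange : ∀ a i b → (a ℕ.+ i) ℕ.+ b ≡ i ℕ.+ (b ℕ.+ a)
      rearrange = ℕ-solve-∀
      counting : ∣ X ∣ ℕ.+ ∣ N G I ∣ ℕ.≤ ∣ I ∣ ℕ.+ ∣ N G X ∣
      counting = begin
        ∣ X ∣ ℕ.+ ∣ N G I ∣                     ≡⟨ ≡.cong (ℕ._+ ∣ N G I ∣) (∣p∣≡∣p∩q∣+∣p∩∁q∣ X (N G X)) ⟩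
        (∣ X ∩ N G X ∣ ℕ.+ ∣ I ∣) ℕ.+ ∣ N G I ∣ ≡⟨ rearrange (∣ X ∩ N G X ∣) (∣ I ∣) (∣ N G I ∣) ⟩
        ∣ I ∣ ℕ.+ (∣ N G I ∣ ℕ.+ ∣ X ∩ N G X ∣) ≤⟨ ℕ.+-monoʳ-≤ (∣ I ∣) parts-of-NX ⟩
        ∣ I ∣ ℕ.+ ∣ N G X ∣                     ∎
        where open ℕ.≤-Reasoning

  -- Critical independent sets are closed under intersection: by
  -- supermodularity and d(A ∪ B) ≤ d(independentPart (A ∪ B)) ≤ d(B),
  -- d(A) ≤ d(A ∩ B), and d(A) is already the maximum.
  Critical-∩ : ∀ {A B} → Critical G A → Critical G B → Critical G (A ∩ B)
  Critical-∩ {A} {B} (indA , maxA) (indB , maxB) = indA∩B , λ I indI → ≤-trans (maxA I indI) dA≤dA∩B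
    where
      indA∩B : Independent G (A ∩ B)
      indA∩B u v u∈ v∈ = indA u v (p∩q⊆p A B u∈) (p∩q⊆p A B v∈)
      dA∪B≤dB : d G (A ∪ B) ≤ d G B
      dA∪B≤dB = ≤-trans (d≤d-independentPart (A ∪ B))
                        (maxB _ (independentPart-independent (A ∪ B)))
      dA≤dA∩B : d G A ≤ d G (A ∩ B)
      dA≤dA∩B = +-cancelʳ-≤ (d G B)
        (≤-trans (d-supermodular A B) (+-monoʳ-≤ (d G (A ∩ B)) dA∪B≤dB))

  Critical⇒d≡ : ∀ {A B} → Critical G A → Critical G B → d G A ≡ d G B
  Critical⇒d≡ (indA , maxA) (indB , maxB) = ≤-antisym (maxB _ indA) (maxA _ indB)

-- The kernel K of G is critical.  Constructively we only get this up to
-- double negation: "v ∉ K" says that not every critical set contains v.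
module Kernel {n : ℕ} (G : Graph n) {K : Subset n} (isKer : IsKer G K) where

  open CriticalSets G using (Critical-∩; Critical⇒d≡)
  open import Data.Integer using (_≟_)
  open import Data.Fin using (Fin)
  open import Data.Fin.Subset using (_∉_; _∩_; _⊆_)
  open import Data.Fin.Subset.Properties using (_∈?_; x∈p∩q⁻; ⊆-antisym)
  open import Data.List using (List; []; _∷_; filter; allFin)
  open import Data.List.Relation.Unary.All as All using (All; []; _∷_)
  open import Data.List.Relation.Unary.All.Properties using (all-filter)
  open import Data.List.Membership.Propositional.Properties using (∈-allFin; ∈-filter⁺)
  open import Data.Product using (∃; _×_; _,_; proj₁; proj₂)
  open import Relation.Nullary using (¬_)
  open import Relation.Nullary.Decidable using (¬?; decidable-stable)

  Avoided : Fin n → Set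
  Avoided v = ∃ λ A → Critical G A × v ∉ A

  avoid-all : ∀ {S} → Critical G S → (vs : List (Fin n)) →
    All (λ v → ¬ ¬ Avoided v) vs → ¬ ¬ (∃ λ C → Critical G C × All (_∉ C) vs)
  avoid-all {S} critS []       []            k = k (S , critS , [])
  avoid-all     critS (v ∷ vs) (avoidv ∷ avs) k =
    avoid-all critS vs avs λ (C , critC , outsideC) →
    avoidv λ (A , critA , v∉A) →
    k (C ∩ A , Critical-∩ critC critA ,
       (λ v∈C∩A → v∉A (proj₂ (x∈p∩q⁻ C A v∈C∩A))) ∷
       All.map (λ w∉C w∈C∩A → w∉C (proj₁ (x∈p∩q⁻ C A w∈C∩A))) outsideC)

  outside-avoided : ∀ {v} → v ∉ K → ¬ ¬ Avoided v
  outside-avoided {v} v∉K noAvoid = v∉K (proj₂ (isKer v) λ A critA →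
    decidable-stable (v ∈? A) λ v∉A → noAvoid (A , critA , v∉A))

  -- A critical set avoiding every vertex outside K is K itself.
  kernel-critical : ∀ {S} → Critical G S → ¬ ¬ Critical G K
  kernel-critical critS notCritK =
    avoid-all critS outsideK (All.map outside-avoided (all-filter notInK? (allFin n)))
      λ (C , critC , outsideC) → notCritK (≡.subst (Critical G) (C≡K critC outsideC) critC)
    where
      notInK? = λ v → ¬? (v ∈? K)
      outsideK : List (Fin n)
      outsideK = filter notInK? (allFin n)
      C≡K : ∀ {C} → Critical G C → All (_∉ C) outsideK → C ≡ K
      C≡K {C} critC outsideC = ⊆-antisym C⊆K (λ {v} v∈K → proj₁ (isKer v) v∈K C critC)
        where
          C⊆K : C ⊆ K
          C⊆K {v} v∈C = decidable-stable (v ∈? K) λ v∉K →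
            All.lookup outsideC (∈-filter⁺ notInK? (∈-allFin v) v∉K) v∈C

  -- The kernel has the maximum difference, being critical; equality of
  -- integers is decidable, so the double negation can be dropped.
  d-kernel : ∀ {S} → Critical G S → d G K ≡ d G S
  d-kernel {S} critS = decidable-stable (d G K ≟ d G S) λ d≢ →
    kernel-critical critS λ critK → d≢ (Critical⇒d≡ critK critS)

open import Data.Integer using (ℤ; _+_; +_; _*_)
import Data.Nat as ℕ
import Data.Nat.Properties as ℕ
open import Data.Product using (_,_; proj₁)
open SubsetCardinality using (∣p∪q∣≡∣p∣+∣q∣)
open Neighbourhood using (independent⇒disjoint-N)
open Differences using (twice≡diff+sum)
open Kernel using (d-kernel)

proposition3p1 : (n : ℕ) (G : Graph n) (S K : Subset n) (α' : ℕ) →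
    MaxCritIndep G S → IsKer G K → IsCritIndepNumber G α' →
    + 2 * + α' ≡ d G K + + ∣ N[_] G S ∣
proposition3p1 n G S K α' (critS , maximumS) isKer ((A , critA , ∣A∣≡α') , maximumα') = begin
  + 2 * + α'                        ≡⟨ ≡.cong (λ k → + 2 * + k) α'≡∣S∣ ⟩
  + 2 * + ∣ S ∣                     ≡⟨ twice≡diff+sum (∣ S ∣) (∣ N G S ∣) ⟩
  d G S + + (∣ N G S ∣ ℕ.+ ∣ S ∣)   ≡⟨ ≡.cong₂ _+_ (≡.sym (d-kernel G isKer critS)) (≡.cong +_ (≡.sym ∣N[S]∣)) ⟩
  d G K + + ∣ N[_] G S ∣            ∎
  where
    open ≡.≡-Reasoning
    α'≡∣S∣ : α' ≡ ∣ S ∣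
    α'≡∣S∣ = ℕ.≤-antisym (≡.subst (ℕ._≤ ∣ S ∣) ∣A∣≡α' (maximumS A critA)) (maximumα' S critS)
    -- S is independent, hence disjoint from N(S).
    ∣N[S]∣ : ∣ N[_] G S ∣ ≡ ∣ N G S ∣ ℕ.+ ∣ S ∣
    ∣N[S]∣ = ∣p∪q∣≡∣p∣+∣q∣ (N G S) S (independent⇒disjoint-N G (proj₁ critS))
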